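{- Let $\mathbf{o}\in\mathbb{R}^{\Upsilon}$ be an SE objective. There exists a unique $\tau_{\mathbf{o}}\in\mathbb{R}^{\Upsilon_c}$ such that $\langle\mathbf{o},\eta\rangle_{\Upsilon}=\langle\tau_{\mathbf{o}},c_\eta\rangle_{\Upsilon_c}$ for every $\eta\in\mathbb{R}^{\Upsilon}$. Specifically, for $T\in\Upsilon_c$, $$\tau_{\mathbf{o}}(T)=\sum_{\emptyset\neq K\subseteq R}(-1)^{|R\setminus K|}\,\mathbf{o}(b|K),$$ where $b\in T$ is arbitrary and $R=T\setminus\{b\}$; in particular this expression does not depend on the choice of $b\in T$.
   Context: Let $N$ be a finite set with $n=|N|\ge 2$, and let $\mathrm{DAG}(N)$ be the set of acyclic directed graphs with node set $N$; $\mathrm{pa}_G(a)$ is the set of parents of $a$ in $G$. $G\sim H$ (Markov equivalence) means same adjacencies and same immoralities. Let $\Upsilon=\{(a|B): a\in N,\ \emptyset\neq B\subseteq N\setminus\{a\}\}$ and $\Upsilon_c=\{S\subseteq N:|S|\ge 2\}$. For $G\in\mathrm{DAG}(N)$, $\eta_G\in\mathbb{R}^{\Upsilon}$ has $\eta_G(a|B)=1$ if $B=\mathrm{pa}_G(a)$ and $0$ otherwise. $\langle\cdot,\cdot\rangle_{\Upsilon}$ and $\langle\cdot,\cdot\rangle_{\Upsilon_c}$ are the standard scalar products on $\mathbb{R}^{\Upsilon}$ and $\mathbb{R}^{\Upsilon_c}$. For $\eta\in\mathbb{R}^{\Upsilon}$, $c_\eta\in\mathbb{R}^{\Upsilon_c}$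 is defined by $c_\eta(S)=\sum_{a\in S}\sum_{B:\,S\setminus\{a\}\subseteq B\subseteq N\setminus\{a\}}\eta(a|B)$. An SE objective is $\mathbf{o}\in\mathbb{R}^{\Upsilon}$ with $\langle\mathbf{o},\eta_G\rangle_{\Upsilon}=\langle\mathbf{o},\eta_H\rangle_{\Upsilon}$ whenever $G\sim H$. Convention: $\mathbf{o}(b|\emptyset)=0$ for $b\in N$. -}

module Defs where

open import Level using (Level)
open import Data.Bool using (Bool; true; false; _∨_; if_then_else_)
open import Data.Nat using (ℕ; zero; suc; _≤?_)
open import Data.Fin using (Fin)
open import Data.Fin.Subset using (Subset; inside; outside; _∈_; _∉_; _⊆_; _─_; ∣_∣; Nonempty) renaming (_-_ to _∖ₛ_)
open import Data.Fin.Subset.Properties using (_∈?_; _⊆?_; nonempty?)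
open import Data.Vec using (Vec; []; _∷_; tabulate)
open import Data.Vec.Properties using (≡-dec)
import Data.Bool.Properties as BoolP
open import Data.List using (List; []; _∷_; [_]; _++_; map; allFin)
open import Data.Product using (_×_; _,_)
open import Relation.Nullary using (¬_; Dec; does; yes; no)

open import Relation.Nullary.Decidable using (_×-dec_; ¬?)
open import Relation.Binary.PropositionalEquality using (_≡_; _≢_)
open import Function.Bundles using (_⇔_)
open import Algebra.Bundles using (CommutativeRing)

allSubsets : (n : ℕ) → List (Subset n)
allSubsets zero    = [ [] ]
allSubsets (suc n) = map (outside ∷_) (allSubsets n) ++ map (inside ∷_) (allSubsets n)

_≟S_ : {n : ℕ} → (p q : Subset n) → Dec (p ≡ q)
_≟S_ = ≡-dec BoolP._≟_

-- Directed graphs on Fin n, given by an edge relation: edge a b = true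
-- means a → b.

data Path {n : ℕ} (E : Fin n → Fin n → Bool) : Fin n → Fin n → Set where
  step : ∀ {a b} → E a b ≡ true → Path E a b
  cons : ∀ {a b c} → E a b ≡ true → Path E b c → Path E a c

record DAG (n : ℕ) : Set where
  field
    edge    : Fin n → Fin n → Bool
    acyclic : ∀ a → ¬ Path edge a a
open DAG public

pa : {n : ℕ} → DAG n → Fin n → Subset n
pa G a = tabulate (λ b → edge G b a)

adjacent : {n : ℕ} → DAG n → Fin n → Fin n → Bool
adjacent G a b = edge G a b ∨ edge G b a

Immorality : {n : ℕ} → DAG n → Fin n → Fin n → Fin n → Set
Immorality G a b c =
  edge G a c ≡ true × edge G b c ≡ true × a ≢ b × adjacent G a b ≡ false

_∼_ : {n : ℕ} → DAG n → DAG n → Set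
G ∼ H = (∀ a b → adjacent G a b ≡ adjacent H a b)
      × (∀ a b c → Immorality G a b c ⇔ Immorality H a b c)

module Linear {c ℓ : Level} (R : CommutativeRing c ℓ) where
  open CommutativeRing R hiding (_-_)

  [_]⇒_ : ∀ {p} {P : Set p} → Dec P → Carrier → Carrier
  [ d ]⇒ x = if does d then x else 0#

  sumL : ∀ {a} {A : Set a} → List A → (A → Carrier) → Carrier
  sumL []       f = 0#
  sumL (x ∷ xs) f = f x + sumL xs f

  neg1^ : ℕ → Carrier
  neg1^ zero    = 1#
  neg1^ (suc k) = (- 1#) * neg1^ k

  -- R^Υ, Υ = {(a|B) : a ∈ N, ∅ ≠ B ⊆ N∖{a}}; a vector is represented as a
  -- function Fin n → Subset n → Carrier, of which only the values at
  -- indices in Υ are ever used.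
  VecΥ : ℕ → Set c
  VecΥ n = Fin n → Subset n → Carrier

  -- R^Υc, Υc = {S ⊆ N : |S| ≥ 2}; only values at S with |S| ≥ 2 are used.
  VecΥc : ℕ → Set c
  VecΥc n = Subset n → Carrier

  inΥ? : {n : ℕ} (a : Fin n) (B : Subset n) → Dec (a ∉ B × Nonempty B)
  inΥ? a B = ¬? (a ∈? B) ×-dec nonempty? B

  ⟨_,_⟩Υ : {n : ℕ} → VecΥ n → VecΥ n → Carrier
  ⟨_,_⟩Υ {n} o η = sumL (allFin n) λ a → sumL (allSubsets n) λ B →
                     [ inΥ? a B ]⇒ (o a B * η a B)

  ⟨_,_⟩Υc : {n : ℕ} → VecΥc n → VecΥc n → Carrier
  ⟨_,_⟩Υc {n} τ κ = sumL (allSubsets n) λ S → [ 2 ≤? ∣ S ∣ ]⇒ (τ S * κ S)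

  cvec : {n : ℕ} → VecΥ n → VecΥc n
  cvec {n} η S = sumL (allFin n) λ a → [ a ∈? S ]⇒
                   (sumL (allSubsets n) λ B → [ inΥ? a B ]⇒ ([ (S ∖ₛ a) ⊆? B ]⇒ η a B))

  ηvec : {n : ℕ} → DAG n → VecΥ n
  ηvec G a B = [ B ≟S pa G a ]⇒ 1#

  IsSE : {n : ℕ} → VecΥ n → Set ℓ
  IsSE {n} o = (G H : DAG n) → G ∼ H → ⟨ o , ηvec G ⟩Υ ≈ ⟨ o , ηvec H ⟩Υ

  formula : {n : ℕ} → VecΥ n → Subset n → Fin n → Carrier
  formula {n} o T b = sumL (allSubsets n) λ K →
    [ (K ⊆? (T ∖ₛ b)) ×-dec nonempty? K ]⇒ (neg1^ ∣ (T ∖ₛ b) ─ K ∣ * o b K)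

module Submission where

-- Pairing with c_η is adjoint to κ ↦ weight κ, where weight κ (a|B) = Σ_{∅ ≠ L ⊆ B} κ(L ∪ {a}) is the
-- zeta transform in B of L ↦ κ(L ∪ {a}).  Hence κ represents o iff, for every a, this zeta transform agrees
-- with o(a|·) on the subsets of N ∖ {a}, and Möbius inversion then forces
-- κ(T) = Σ_{K ⊆ T∖b} (-1)^|T∖b ∖ K| o(b|K) for every b ∈ T: this gives uniqueness and the formula.
-- Existence needs that Möbius sum to be independent of b ∈ T.  Splitting off a second node c ∈ T reduces
-- this to o(b|M) + o(c|M ∪ {b}) = o(c|M) + o(b|M ∪ {c}) for b, c ∉ M, which is score equivalence for the
-- DAGs M → b, M ∪ {b} → c and M → c, M ∪ {c} → b; they differ by reversing a covered edge, so they are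
-- Markov equivalent.

open import Defs
open import Level using (Level)
open import Data.Bool using (true; false; _∨_; if_then_else_)
open import Data.Bool.Properties using (∨-zeroʳ; ∨-comm)
open import Data.Nat using (ℕ; zero; suc; _≤_; _<_; _≤?_; s≤s; s≤s⁻¹; z≤n)
open import Data.Nat.Properties using (<-irrefl; <-trans; ≤-trans)
open import Data.Fin using (Fin; zero; suc)
open import Data.Fin.Properties using (_≟_)
open import Data.Fin.Subset using (Subset; inside; outside; ⊥; ⁅_⁆; _─_; ∣_∣; _∈_; _∉_; _⊆_; Nonempty)
  renaming (_-_ to _∖ₛ_)
open import Data.Fin.Subset.Properties
  using (_∈?_; _⊆?_; nonempty?; p─⊥≡p; p─q─r≡p─r─q; Empty-unique; ∣⊥∣≡0; ∣⁅x⁆∣≡1; p⊆q⇒∣p∣≤∣q∣; x∈⁅y⁆⇒x≡y;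
         ⊆-antisym; ⊆-refl; ⊥⊆; ∉⊥)
open import Data.Vec using ([]; _∷_; here; there; _[_]≔_; lookup)
open import Data.Vec.Properties using (tabulate∘lookup; lookup⇒[]=; []=⇒lookup; lookup∘update′)
open import Data.List using (List; []; _∷_; _++_; map; allFin)
open import Data.List.Properties using (map-tabulate)
open import Data.Product using (Σ; _×_; _,_; proj₁; proj₂; swap)
open import Data.Empty using (⊥-elim)
open import Function using (_∘_)
open import Function.Bundles using (_⇔_; mk⇔; Equivalence)
open import Relation.Nullary using (¬_; Dec; does; yes; no; contradiction)
open import Relation.Nullary.Decidable using (_×-dec_; ¬?; does-⇔; dec-true; dec-false)
open import Relation.Binary.PropositionalEquality as ≡ using (_≡_; _≢_)
open import Algebra.Bundles using (CommutativeRing)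

private
  variable
    n : ℕ

module SubsetFacts where
  open ≡ using (refl; sym; trans; cong; subst)

  infixl 5 _+ₛ_
  _+ₛ_ : Subset n → Fin n → Subset n
  p +ₛ x = p [ x ]≔ inside

  ∈-+ₛ : (p : Subset n) (x : Fin n) → x ∈ p +ₛ x
  ∈-+ₛ (_ ∷ p) zero    = here
  ∈-+ₛ (_ ∷ p) (suc x) = there (∈-+ₛ p x)

  ∈-+ₛ⁺ : {p : Subset n} {x y : Fin n} → y ∈ p → y ∈ p +ₛ x
  ∈-+ₛ⁺ {p = _ ∷ _} {zero}  here      = here
  ∈-+ₛ⁺ {p = _ ∷ _} {zero}  (there h) = there h
  ∈-+ₛ⁺ {p = _ ∷ _} {suc x} here      = here
  ∈-+ₛ⁺ {p = _ ∷ _} {suc x} (there h) = there (∈-+ₛ⁺ h)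

  ∈-+ₛ⁻ : {p : Subset n} {x y : Fin n} → y ≢ x → y ∈ p +ₛ x → y ∈ p
  ∈-+ₛ⁻ {p = _ ∷ _} {zero}  {zero}  y≢x _         = contradiction refl y≢x
  ∈-+ₛ⁻ {p = _ ∷ _} {zero}  {suc y} y≢x (there h) = there h
  ∈-+ₛ⁻ {p = _ ∷ _} {suc x} {zero}  y≢x here      = here
  ∈-+ₛ⁻ {p = _ ∷ _} {suc x} {suc y} y≢x (there h) = there (∈-+ₛ⁻ (y≢x ∘ cong suc) h)

  ∉-∖ₛ : (p : Subset n) (x : Fin n) → x ∉ p ∖ₛ x
  ∉-∖ₛ (_ ∷ p) zero    ()
  ∉-∖ₛ (_ ∷ p) (suc x) (there h) = ∉-∖ₛ p x h

  ∈-∖ₛ⁺ : {p : Subset n} {x y : Fin n} → y ≢ x → y ∈ p → y ∈ p ∖ₛ x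
  ∈-∖ₛ⁺ {p = _ ∷ p} {zero}  {zero}  y≢x _         = contradiction refl y≢x
  ∈-∖ₛ⁺ {p = _ ∷ p} {zero}  {suc y} y≢x (there h) = there (subst (y ∈_) (sym (p─⊥≡p p)) h)
  ∈-∖ₛ⁺ {p = _ ∷ p} {suc x} {zero}  y≢x here      = here
  ∈-∖ₛ⁺ {p = _ ∷ p} {suc x} {suc y} y≢x (there h) = there (∈-∖ₛ⁺ (y≢x ∘ cong suc) h)

  ∖ₛ-+ₛ : {p : Subset n} {x : Fin n} → x ∈ p → p ∖ₛ x +ₛ x ≡ p
  ∖ₛ-+ₛ {p = _ ∷ p} {zero}  here      = cong (inside ∷_) (p─⊥≡p p)
  ∖ₛ-+ₛ {p = y ∷ p} {suc x} (there h) = cong (y ∷_) (∖ₛ-+ₛ h)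

  +ₛ-∖ₛ : {p : Subset n} {x : Fin n} → x ∉ p → p +ₛ x ∖ₛ x ≡ p
  +ₛ-∖ₛ {p = outside ∷ p} {zero}  x∉p = cong (outside ∷_) (p─⊥≡p p)
  +ₛ-∖ₛ {p = inside  ∷ p} {zero}  x∉p = contradiction here x∉p
  +ₛ-∖ₛ {p = y ∷ p}       {suc x} x∉p = cong (y ∷_) (+ₛ-∖ₛ (x∉p ∘ there))

  ∣+ₛ∣ : {p : Subset n} {x : Fin n} → x ∉ p → ∣ p +ₛ x ∣ ≡ suc ∣ p ∣
  ∣+ₛ∣ {p = outside ∷ p} {zero}  x∉p = refl
  ∣+ₛ∣ {p = inside  ∷ p} {zero}  x∉p = contradiction here x∉p
  ∣+ₛ∣ {p = outside ∷ p} {suc x} x∉p = ∣+ₛ∣ (x∉p ∘ there)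
  ∣+ₛ∣ {p = inside  ∷ p} {suc x} x∉p = cong suc (∣+ₛ∣ (x∉p ∘ there))

  ⊆-+ₛ⇔ : {L M : Subset n} {c : Fin n} → c ∉ L → (L ⊆ M +ₛ c) ⇔ (L ⊆ M)
  ⊆-+ₛ⇔ c∉L = mk⇔ (λ L⊆M+c {y} y∈L → ∈-+ₛ⁻ (λ { refl → c∉L y∈L }) (L⊆M+c y∈L)) (λ L⊆M {y} y∈L → ∈-+ₛ⁺ (L⊆M y∈L))

  +ₛ-⊆-+ₛ⇔ : {L M : Subset n} {c : Fin n} → c ∉ L → (L +ₛ c ⊆ M +ₛ c) ⇔ (L ⊆ M)
  +ₛ-⊆-+ₛ⇔ {L = L} {M} {c} c∉L = mk⇔ to from
    where
    to : L +ₛ c ⊆ M +ₛ c → L ⊆ M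
    to L+c⊆M+c = Equivalence.to (⊆-+ₛ⇔ c∉L) (λ y∈L → L+c⊆M+c (∈-+ₛ⁺ y∈L))
    from : L ⊆ M → L +ₛ c ⊆ M +ₛ c
    from L⊆M {y} y∈L+c with y ≟ c
    ... | yes refl = ∈-+ₛ M c
    ... | no y≢c   = ∈-+ₛ⁺ (L⊆M (∈-+ₛ⁻ y≢c y∈L+c))

  ∣+ₛ─∣ : {L M : Subset n} {c : Fin n} → c ∉ L → c ∉ M → ∣ M +ₛ c ─ L ∣ ≡ suc ∣ M ─ L ∣
  ∣+ₛ─∣ {L = outside ∷ L} {outside ∷ M} {zero} c∉L c∉M = refl
  ∣+ₛ─∣ {L = inside  ∷ L} {_       ∷ M} {zero} c∉L c∉M = contradiction here c∉L
  ∣+ₛ─∣ {L = outside ∷ L} {inside  ∷ M} {zero} c∉L c∉M = contradiction here c∉M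
  ∣+ₛ─∣ {L = outside ∷ L} {outside ∷ M} {suc c} c∉L c∉M = ∣+ₛ─∣ (c∉L ∘ there) (c∉M ∘ there)
  ∣+ₛ─∣ {L = outside ∷ L} {inside  ∷ M} {suc c} c∉L c∉M = cong suc (∣+ₛ─∣ (c∉L ∘ there) (c∉M ∘ there))
  ∣+ₛ─∣ {L = inside  ∷ L} {_       ∷ M} {suc c} c∉L c∉M = ∣+ₛ─∣ (c∉L ∘ there) (c∉M ∘ there)

  ∣+ₛ─+ₛ∣ : {L M : Subset n} {c : Fin n} → c ∉ M → ∣ (M +ₛ c) ─ (L +ₛ c) ∣ ≡ ∣ M ─ L ∣
  ∣+ₛ─+ₛ∣ {L = outside ∷ L} {outside ∷ M} {zero} c∉M = refl
  ∣+ₛ─+ₛ∣ {L = inside  ∷ L} {outside ∷ M} {zero} c∉M = refl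
  ∣+ₛ─+ₛ∣ {L = _       ∷ L} {inside  ∷ M} {zero} c∉M = contradiction here c∉M
  ∣+ₛ─+ₛ∣ {L = outside ∷ L} {outside ∷ M} {suc c} c∉M = ∣+ₛ─+ₛ∣ (c∉M ∘ there)
  ∣+ₛ─+ₛ∣ {L = outside ∷ L} {inside  ∷ M} {suc c} c∉M = cong suc (∣+ₛ─+ₛ∣ (c∉M ∘ there))
  ∣+ₛ─+ₛ∣ {L = inside  ∷ L} {_       ∷ M} {suc c} c∉M = ∣+ₛ─+ₛ∣ (c∉M ∘ there)

  Nonempty⇔1≤∣p∣ : {p : Subset n} → Nonempty p ⇔ (1 ≤ ∣ p ∣)
  Nonempty⇔1≤∣p∣ {n} {p} = mk⇔ to from
    where
    to : Nonempty p → 1 ≤ ∣ p ∣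
    to (x , x∈p) = subst (_≤ ∣ p ∣) (∣⁅x⁆∣≡1 x) (p⊆q⇒∣p∣≤∣q∣ (λ y∈⁅x⁆ → subst (_∈ p) (sym (x∈⁅y⁆⇒x≡y x y∈⁅x⁆)) x∈p))
    from : 1 ≤ ∣ p ∣ → Nonempty p
    from 1≤∣p∣ with nonempty? p
    ... | yes ne = ne
    ... | no  em with () ← subst (1 ≤_) (trans (cong ∣_∣ (Empty-unique em)) (∣⊥∣≡0 n)) 1≤∣p∣

  2≤∣+ₛ∣⇔Nonempty : {p : Subset n} {x : Fin n} → x ∉ p → (2 ≤ ∣ p +ₛ x ∣) ⇔ Nonempty p
  2≤∣+ₛ∣⇔Nonempty {p = p} x∉p = mk⇔
    (λ 2≤ → Equivalence.from Nonempty⇔1≤∣p∣ (s≤s⁻¹ (subst (2 ≤_) (∣+ₛ∣ x∉p) 2≤)))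
    (λ ne → subst (2 ≤_) (sym (∣+ₛ∣ x∉p)) (s≤s (Equivalence.to Nonempty⇔1≤∣p∣ ne)))

  ⊆⊥⇔≡⊥ : {p : Subset n} → (p ⊆ ⊥) ⇔ (p ≡ ⊥)
  ⊆⊥⇔≡⊥ {p = p} = mk⇔ to (λ p≡⊥ → subst (_⊆ ⊥) (sym p≡⊥) ⊆-refl)
    where
    to : p ⊆ ⊥ → p ≡ ⊥
    to p⊆⊥ = ⊆-antisym p⊆⊥ ⊥⊆

open SubsetFacts

module CoveredReversals where
  open ≡ using (refl; sym; trans; cong; cong₂)

  private
    variable
      G H : DAG n
      b c x y z : Fin n

  no-loop : (G : DAG n) → ¬ (edge G x x ≡ true)
  no-loop G x→x = acyclic G _ (step x→x)

  no-2-cycle : (G : DAG n) → edge G x y ≡ true → ¬ (edge G y x ≡ true)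
  no-2-cycle G x→y y→x = acyclic G _ (cons x→y (step y→x))

  -- The edge b → c of G is covered (pa c = pa b ∪ {b}), and H is G with that edge reversed.
  record CoveredReversal (G H : DAG n) (b c : Fin n) : Set where
    field
      edge-bc   : edge G b c ≡ true
      edge-cb   : edge H c b ≡ true
      unchanged : ∀ x y → ¬ (x ≡ b × y ≡ c) → ¬ (x ≡ c × y ≡ b) → edge G x y ≡ edge H x y
      covered   : ∀ z → z ≢ b → z ≢ c → edge G z b ≡ edge G z c

  reverse : CoveredReversal G H b c → CoveredReversal H G c b
  reverse {b = b} {c} r = record
    { edge-bc   = edge-cb
    ; edge-cb   = edge-bc
    ; unchanged = λ x y f g → sym (unchanged x y g f)
    ; covered   = λ z z≢c z≢b → trans (sym (unchanged z c (z≢b ∘ proj₁) (z≢c ∘ proj₁)))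
                                 (trans (sym (covered z z≢b z≢c)) (unchanged z b (z≢b ∘ proj₁) (z≢c ∘ proj₁)))
    }
    where open CoveredReversal r

  data PairView (b c : Fin n) : Fin n → Fin n → Set where
    forward  : PairView b c b c
    backward : PairView b c c b
    other    : ∀ {x y} → ¬ (x ≡ b × y ≡ c) → ¬ (x ≡ c × y ≡ b) → PairView b c x y

  pairView : (b c x y : Fin n) → PairView b c x y
  pairView b c x y with (x ≟ b) ×-dec (y ≟ c) | (x ≟ c) ×-dec (y ≟ b)
  ... | yes (refl , refl) | _                  = forward
  ... | no _              | yes (refl , refl)  = backward
  ... | no ¬f             | no ¬g              = other ¬f ¬g

  module _ (r : CoveredReversal G H b c) where
    open CoveredReversal r

    adjacent-≡ : ∀ x y → adjacent G x y ≡ adjacent H x y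
    adjacent-≡ x y with pairView b c x y
    ... | forward    = trans (cong (_∨ edge G c b) edge-bc) (sym (trans (cong (edge H b c ∨_) edge-cb) (∨-zeroʳ _)))
    ... | backward   = trans (cong (edge G c b ∨_) edge-bc) (trans (∨-zeroʳ _) (sym (cong (_∨ edge H b c) edge-cb)))
    ... | other ¬f ¬g = cong₂ _∨_ (unchanged x y ¬f ¬g) (unchanged y x (¬g ∘ swap) (¬f ∘ swap))

    -- The covered edge b → c lies in no immorality: any other parent of c is a parent of b, hence adjacent to b.
    immorality-parent : ∀ x z y → edge G x y ≡ true → edge G z y ≡ true → x ≢ z → adjacent G x z ≡ false →
                        edge H x y ≡ true
    immorality-parent x z y x→y z→y x≢z x≁z with pairView b c x y
    ... | backward    = ⊥-elim (no-2-cycle G edge-bc x→y)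
    ... | other ¬f ¬g = trans (sym (unchanged x y ¬f ¬g)) x→y
    ... | forward with z ≟ c
    ...   | yes refl = ⊥-elim (no-loop G z→y)
    ...   | no z≢c   with () ← trans (sym x≁z) (trans (cong (edge G b z ∨_) (trans (covered z (x≢z ∘ sym) z≢c) z→y)) (∨-zeroʳ _))

    immorality-kept : ∀ x z y → Immorality G x z y → Immorality H x z y
    immorality-kept x z y (x→y , z→y , x≢z , x≁z) =
        immorality-parent x z y x→y z→y x≢z x≁z
      , immorality-parent z x y z→y x→y (x≢z ∘ sym) (trans (∨-comm (edge G z x) (edge G x z)) x≁z)
      , x≢z
      , trans (sym (adjacent-≡ x z)) x≁z

  covered-reversal-∼ : CoveredReversal G H b c → G ∼ H
  covered-reversal-∼ r = adjacent-≡ r , λ x z y → mk⇔ (immorality-kept r x z y) (immorality-kept (reverse r) x z y)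

open CoveredReversals

module CoverGraphs where
  open ≡ using (refl; sym; trans; cong; subst; subst₂)

  private
    variable
      b c x y : Fin n
      A : Set

  fromParents : (P : Fin n → Subset n) (rank : Fin n → ℕ) → (∀ {x y} → x ∈ P y → rank x < rank y) → DAG n
  fromParents P rank rank-< = record { edge = λ x y → lookup (P y) x ; acyclic = λ a p → <-irrefl refl (path-< p) }
    where
    path-< : Path (λ x y → lookup (P y) x) x y → rank x < rank y
    path-< (step x→y)     = rank-< (lookup⇒[]= _ _ x→y)
    path-< (cons x→y y→z) = <-trans (rank-< (lookup⇒[]= _ _ x→y)) (path-< y→z)

  pa-fromParents : (P : Fin n → Subset n) (rank : Fin n → ℕ) (rank-< : ∀ {x y} → x ∈ P y → rank x < rank y) →
                   ∀ y → pa (fromParents P rank rank-<) y ≡ P y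
  pa-fromParents P _ _ y = tabulate∘lookup (P y)

  byRole : (b c : Fin n) → A → A → A → Fin n → A
  byRole b c u v w y = if does (y ≟ b) then u else if does (y ≟ c) then v else w

  data Role (b c : Fin n) : Fin n → Set where
    is-b    : Role b c b
    is-c    : Role b c c
    neither : ∀ {y} → y ≢ b → y ≢ c → Role b c y

  role : (b c y : Fin n) → Role b c y
  role b c y with y ≟ b | y ≟ c
  ... | yes refl | _        = is-b
  ... | no _     | yes refl = is-c
  ... | no y≢b   | no y≢c   = neither y≢b y≢c

  byRole-b : (b c : Fin n) (u v w : A) → byRole b c u v w b ≡ u
  byRole-b b c u v w rewrite dec-true (b ≟ b) refl = refl

  byRole-c : {b c : Fin n} → b ≢ c → (u v w : A) → byRole b c u v w c ≡ v
  byRole-c {b = b} {c} b≢c u v w rewrite dec-false (c ≟ b) (b≢c ∘ sym) | dec-true (c ≟ c) refl = refl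

  byRole-neither : {b c y : Fin n} → y ≢ b → y ≢ c → (u v w : A) → byRole b c u v w y ≡ w
  byRole-neither {b = b} {c} {y} y≢b y≢c u v w rewrite dec-false (y ≟ b) y≢b | dec-false (y ≟ c) y≢c = refl

  module Cover {b c : Fin n} (b≢c : b ≢ c) {M : Subset n} (b∉M : b ∉ M) (c∉M : c ∉ M) where

    parents : Fin n → Subset n
    parents = byRole b c M (M +ₛ b) ⊥

    rank : Fin n → ℕ
    rank = byRole b c 1 2 0

    parents-b : parents b ≡ M
    parents-b = byRole-b b c M (M +ₛ b) ⊥

    parents-c : parents c ≡ M +ₛ b
    parents-c = byRole-c b≢c M (M +ₛ b) ⊥

    parents-neither : y ≢ b → y ≢ c → parents y ≡ ⊥
    parents-neither y≢b y≢c = byRole-neither y≢b y≢c M (M +ₛ b) ⊥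

    rank-b : rank b ≡ 1
    rank-b = byRole-b b c 1 2 0

    rank-c : rank c ≡ 2
    rank-c = byRole-c b≢c 1 2 0

    rank-M : x ∈ M → rank x ≡ 0
    rank-M {x} x∈M = byRole-neither {b = b} {c} {x} (λ { refl → b∉M x∈M }) (λ { refl → c∉M x∈M }) 1 2 0

    rank-< : ∀ {x y} → x ∈ parents y → rank x < rank y
    rank-< {x} {y} x∈Py with role b c y
    ... | is-b = subst₂ _<_ (sym (rank-M (subst (x ∈_) parents-b x∈Py))) (sym rank-b) (s≤s z≤n)
    ... | neither y≢b y≢c = ⊥-elim (∉⊥ (subst (x ∈_) (parents-neither y≢b y≢c) x∈Py))
    ... | is-c with role b c x
    ...   | is-b         = subst₂ _<_ (sym rank-b) (sym rank-c) (s≤s (s≤s z≤n))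
    ...   | is-c         = ⊥-elim (c∉M (∈-+ₛ⁻ (b≢c ∘ sym) (subst (c ∈_) parents-c x∈Py)))
    ...   | neither x≢b _ = subst₂ _<_ (sym (rank-M (∈-+ₛ⁻ x≢b (subst (x ∈_) parents-c x∈Py)))) (sym rank-c) (s≤s z≤n)

    graph : DAG n
    graph = fromParents parents rank (λ {x} {y} → rank-< {x} {y})

    pa-graph : ∀ y → pa graph y ≡ parents y
    pa-graph = pa-fromParents parents rank (λ {x} {y} → rank-< {x} {y})


  cover-reversal : {b c : Fin n} (b≢c : b ≢ c) {M : Subset n} (b∉M : b ∉ M) (c∉M : c ∉ M) →
                   CoveredReversal (Cover.graph b≢c b∉M c∉M) (Cover.graph (b≢c ∘ sym) c∉M b∉M) b c
  cover-reversal {b = b} {c} b≢c {M} b∉M c∉M = record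
    { edge-bc   = []=⇒lookup (subst (b ∈_) (sym G.parents-c) (∈-+ₛ M b))
    ; edge-cb   = []=⇒lookup (subst (c ∈_) (sym H.parents-c) (∈-+ₛ M c))
    ; unchanged = unchanged
    ; covered   = λ z z≢b z≢c → trans (cong (λ P → lookup P z) G.parents-b)
                                (trans (sym (lookup∘update′ z≢b M inside)) (cong (λ P → lookup P z) (sym G.parents-c)))
    }
    where
    module G = Cover b≢c b∉M c∉M
    module H = Cover (b≢c ∘ sym) c∉M b∉M

    unchanged : ∀ x y → ¬ (x ≡ b × y ≡ c) → ¬ (x ≡ c × y ≡ b) → lookup (G.parents y) x ≡ lookup (H.parents y) x
    unchanged x y ¬f ¬g with role b c y
    ... | is-b   = trans (cong (λ P → lookup P x) G.parents-b)
                         (trans (sym (lookup∘update′ (λ x≡c → ¬g (x≡c , refl)) M inside)) (cong (λ P → lookup P x) (sym H.parents-c)))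
    ... | is-c   = trans (cong (λ P → lookup P x) G.parents-c)
                         (trans (lookup∘update′ (λ x≡b → ¬f (x≡b , refl)) M inside) (cong (λ P → lookup P x) (sym H.parents-b)))
    ... | neither y≢b y≢c = cong (λ P → lookup P x) (trans (G.parents-neither y≢b y≢c) (sym (H.parents-neither y≢c y≢b)))

open CoverGraphs

module _ {c ℓ : Level} (R : CommutativeRing c ℓ) where
  open CommutativeRing R hiding (zero)
  open Linear R
  open import Algebra.Properties.Ring ring using (-1*x≈-x; -0#≈0#; x[y-z]≈xy-xz)
  open import Algebra.Properties.CommutativeSemigroup +-commutativeSemigroup using (interchange)
  open import Relation.Binary.Reasoning.Setoid setoid

  private
    variable
      p q : Level
      P Q U V : Set p
      A B : Set p
      x y : Carrier

  []⇒-yes : (d : Dec P) → P → [ d ]⇒ x ≡ x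
  []⇒-yes (yes _) _ = ≡.refl
  []⇒-yes (no ¬P) P = contradiction P ¬P

  []⇒-no : (d : Dec P) → ¬ P → [ d ]⇒ x ≡ 0#
  []⇒-no (yes P) ¬P = contradiction P ¬P
  []⇒-no (no _)  _  = ≡.refl

  []⇒-cong : (d : Dec P) → (P → x ≈ y) → [ d ]⇒ x ≈ [ d ]⇒ y
  []⇒-cong (yes P) x≈y = x≈y P
  []⇒-cong (no _)  _   = refl

  []⇒-⇔ : P ⇔ Q → (d : Dec P) (e : Dec Q) → [ d ]⇒ x ≡ [ e ]⇒ x
  []⇒-⇔ P⇔Q d e = ≡.cong (λ b → if b then _ else 0#) (does-⇔ P⇔Q d e)

  []⇒-× : (d : Dec P) (e : Dec Q) → [ d ×-dec e ]⇒ x ≡ [ d ]⇒ ([ e ]⇒ x)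
  []⇒-× (yes _) e = ≡.refl
  []⇒-× (no _)  e = ≡.refl

  []⇒-comm : (d : Dec P) (e : Dec Q) → [ d ]⇒ ([ e ]⇒ x) ≡ [ e ]⇒ ([ d ]⇒ x)
  []⇒-comm (yes _) e       = ≡.refl
  []⇒-comm (no _)  (yes _) = ≡.refl
  []⇒-comm (no _)  (no _)  = ≡.refl

  []⇒-*ˡ : (d : Dec P) → [ d ]⇒ x * y ≈ [ d ]⇒ (x * y)
  []⇒-*ˡ (yes _) = refl
  []⇒-*ˡ (no _)  = zeroˡ _

  []⇒-*ʳ : (d : Dec P) → x * [ d ]⇒ y ≈ [ d ]⇒ (x * y)
  []⇒-*ʳ (yes _) = refl
  []⇒-*ʳ (no _)  = zeroʳ _

  []⇒1#-* : (d : Dec P) → [ d ]⇒ 1# * x ≈ [ d ]⇒ x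
  []⇒1#-* d = trans ([]⇒-*ˡ d) ([]⇒-cong d (λ _ → *-identityˡ _))

  *-[]⇒1# : (d : Dec P) → x * [ d ]⇒ 1# ≈ [ d ]⇒ x
  *-[]⇒1# d = trans ([]⇒-*ʳ d) ([]⇒-cong d (λ _ → *-identityʳ _))

  []⇒-elim : (d : Dec P) → (P → x ≈ y) → (¬ P → 0# ≈ y) → [ d ]⇒ x ≈ y
  []⇒-elim (yes P) x≈y _   = x≈y P
  []⇒-elim (no ¬P) _   0≈y = 0≈y ¬P

  by-cases : Dec P → (P → x ≈ y) → (¬ P → x ≈ y) → x ≈ y
  by-cases (yes P) x≈y _ = x≈y P
  by-cases (no ¬P) _ x≈y = x≈y ¬P

  []⇒-0 : (d : Dec P) → [ d ]⇒ 0# ≡ 0#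
  []⇒-0 (yes _) = ≡.refl
  []⇒-0 (no _)  = ≡.refl

  []⇒-+ : (d : Dec P) → [ d ]⇒ x + [ d ]⇒ y ≈ [ d ]⇒ (x + y)
  []⇒-+ (yes _) = refl
  []⇒-+ (no _)  = +-identityˡ 0#

  []⇒-neg : (d : Dec P) → - [ d ]⇒ x ≈ [ d ]⇒ (- x)
  []⇒-neg (yes _) = refl
  []⇒-neg (no _)  = -0#≈0#

  sumL-cong : (xs : List A) {f g : A → Carrier} → (∀ x → f x ≈ g x) → sumL xs f ≈ sumL xs g
  sumL-cong []       f≈g = refl
  sumL-cong (x ∷ xs) f≈g = +-cong (f≈g x) (sumL-cong xs f≈g)

  sumL-0 : (xs : List A) {f : A → Carrier} → (∀ x → f x ≈ 0#) → sumL xs f ≈ 0#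
  sumL-0 []       f≈0 = refl
  sumL-0 (x ∷ xs) f≈0 = trans (+-cong (f≈0 x) (sumL-0 xs f≈0)) (+-identityˡ 0#)

  sumL-+ : (xs : List A) (f g : A → Carrier) → sumL xs (λ x → f x + g x) ≈ sumL xs f + sumL xs g
  sumL-+ []       f g = sym (+-identityˡ 0#)
  sumL-+ (x ∷ xs) f g = trans (+-congˡ (sumL-+ xs f g)) (interchange (f x) (g x) _ _)

  sumL-*ˡ : (xs : List A) (f : A → Carrier) → x * sumL xs f ≈ sumL xs (λ a → x * f a)
  sumL-*ˡ []       f = zeroʳ _
  sumL-*ˡ (a ∷ xs) f = trans (distribˡ _ (f a) _) (+-congˡ (sumL-*ˡ xs f))

  sumL-*ʳ : (xs : List A) (f : A → Carrier) → sumL xs f * x ≈ sumL xs (λ a → f a * x)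
  sumL-*ʳ xs f = trans (*-comm _ _) (trans (sumL-*ˡ xs f) (sumL-cong xs (λ a → *-comm _ (f a))))

  []⇒-sumL : (d : Dec P) (xs : List A) (f : A → Carrier) → [ d ]⇒ sumL xs f ≈ sumL xs (λ a → [ d ]⇒ f a)
  []⇒-sumL (yes _) xs f = refl
  []⇒-sumL (no _)  xs f = sym (sumL-0 xs (λ _ → refl))

  sumL-neg : (xs : List A) (f : A → Carrier) → - sumL xs f ≈ sumL xs (λ a → - f a)
  sumL-neg xs f = trans (sym (-1*x≈-x _)) (trans (sumL-*ˡ xs f) (sumL-cong xs (λ a → -1*x≈-x (f a))))

  sumL-++ : (xs ys : List A) (f : A → Carrier) → sumL (xs ++ ys) f ≈ sumL xs f + sumL ys f
  sumL-++ []       ys f = sym (+-identityˡ _)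
  sumL-++ (x ∷ xs) ys f = trans (+-congˡ (sumL-++ xs ys f)) (sym (+-assoc _ _ _))

  sumL-map : (g : B → A) (xs : List B) (f : A → Carrier) → sumL (map g xs) f ≡ sumL xs (f ∘ g)
  sumL-map g []       f = ≡.refl
  sumL-map g (x ∷ xs) f = ≡.cong (f (g x) +_) (sumL-map g xs f)

  sumL-comm : (xs : List A) (ys : List B) (f : A → B → Carrier) →
              sumL xs (λ x → sumL ys (f x)) ≈ sumL ys (λ y → sumL xs (λ x → f x y))
  sumL-comm []       ys f = sym (sumL-0 ys (λ _ → refl))
  sumL-comm (x ∷ xs) ys f = trans (+-congˡ (sumL-comm xs ys f)) (sym (sumL-+ ys (f x) _))

  ∑ₛ : (Subset n → Carrier) → Carrier
  ∑ₛ = sumL (allSubsets _)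

  ∑ᶠ : (Fin n → Carrier) → Carrier
  ∑ᶠ = sumL (allFin _)

  ∑ₛ-cong : {f g : Subset n → Carrier} → (∀ S → f S ≈ g S) → ∑ₛ f ≈ ∑ₛ g
  ∑ₛ-cong = sumL-cong (allSubsets _)

  ∑ᶠ-cong : {f g : Fin n → Carrier} → (∀ a → f a ≈ g a) → ∑ᶠ f ≈ ∑ᶠ g
  ∑ᶠ-cong = sumL-cong (allFin _)

  ∑ₛ-0 : {f : Subset n → Carrier} → (∀ S → f S ≈ 0#) → ∑ₛ f ≈ 0#
  ∑ₛ-0 = sumL-0 (allSubsets _)

  ∑ₛ-suc : (f : Subset (suc n) → Carrier) → ∑ₛ f ≈ ∑ₛ (λ S → f (outside ∷ S)) + ∑ₛ (λ S → f (inside ∷ S))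
  ∑ₛ-suc {n} f = trans (sumL-++ (map (outside ∷_) (allSubsets n)) _ f)
    (+-cong (reflexive (sumL-map _ (allSubsets n) f)) (reflexive (sumL-map _ (allSubsets n) f)))

  ∑ᶠ-suc : (f : Fin (suc n) → Carrier) → ∑ᶠ f ≡ f zero + ∑ᶠ (f ∘ suc)
  ∑ᶠ-suc {n} f = ≡.cong (f zero +_) (≡.trans (≡.cong (λ xs → sumL xs f) (≡.sym (map-tabulate (λ i → i) suc)))
                                               (sumL-map suc (allFin n) f))

  ∑ₛ-delta : (P : Subset n) (h : Subset n → Carrier) → ∑ₛ (λ K → [ K ≟S P ]⇒ h K) ≈ h P
  ∑ₛ-delta []            h = +-identityʳ _
  ∑ₛ-delta {suc n} (outside ∷ P) h = begin
    ∑ₛ (λ K → [ K ≟S (outside ∷ P) ]⇒ h K)                  ≈⟨ ∑ₛ-suc {n} _ ⟩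
    ∑ₛ (λ K → [ K ≟S P ]⇒ h (outside ∷ K)) + ∑ₛ {n} (λ _ → 0#) ≈⟨ +-congˡ (∑ₛ-0 {n} (λ _ → refl)) ⟩
    ∑ₛ (λ K → [ K ≟S P ]⇒ h (outside ∷ K)) + 0#               ≈⟨ +-identityʳ _ ⟩
    ∑ₛ (λ K → [ K ≟S P ]⇒ h (outside ∷ K))                    ≈⟨ ∑ₛ-delta P (h ∘ (outside ∷_)) ⟩
    h (outside ∷ P)                                            ∎
  ∑ₛ-delta {suc n} (inside ∷ P) h = begin
    ∑ₛ (λ K → [ K ≟S (inside ∷ P) ]⇒ h K)                   ≈⟨ ∑ₛ-suc {n} _ ⟩
    ∑ₛ {n} (λ _ → 0#) + ∑ₛ (λ K → [ K ≟S P ]⇒ h (inside ∷ K)) ≈⟨ +-congʳ (∑ₛ-0 {n} (λ _ → refl)) ⟩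
    0# + ∑ₛ (λ K → [ K ≟S P ]⇒ h (inside ∷ K))                ≈⟨ +-identityˡ _ ⟩
    ∑ₛ (λ K → [ K ≟S P ]⇒ h (inside ∷ K))                     ≈⟨ ∑ₛ-delta P (h ∘ (inside ∷_)) ⟩
    h (inside ∷ P)                                             ∎

  ∑ᶠ-delta : (a₀ : Fin n) (h : Fin n → Carrier) → ∑ᶠ (λ a → [ a ≟ a₀ ]⇒ h a) ≈ h a₀
  ∑ᶠ-delta {suc n} zero     h = begin
    ∑ᶠ (λ a → [ a ≟ zero ]⇒ h a) ≡⟨ ∑ᶠ-suc (λ a → [ a ≟ zero ]⇒ h a) ⟩
    h zero + ∑ᶠ {n} (λ _ → 0#)   ≈⟨ +-congˡ (sumL-0 (allFin n) (λ _ → refl)) ⟩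
    h zero + 0#                  ≈⟨ +-identityʳ _ ⟩
    h zero                       ∎
  ∑ᶠ-delta {suc n} (suc a₀) h = begin
    ∑ᶠ (λ a → [ a ≟ suc a₀ ]⇒ h a)           ≡⟨ ∑ᶠ-suc (λ a → [ a ≟ suc a₀ ]⇒ h a) ⟩
    0# + ∑ᶠ (λ a → [ a ≟ a₀ ]⇒ h (suc a))    ≈⟨ +-identityˡ _ ⟩
    ∑ᶠ (λ a → [ a ≟ a₀ ]⇒ h (suc a))         ≈⟨ ∑ᶠ-delta a₀ (h ∘ suc) ⟩
    h (suc a₀)                               ∎

  ∑ₛ-split : (c : Fin n) (f : Subset n → Carrier) → ∑ₛ f ≈ ∑ₛ (λ L → [ ¬? (c ∈? L) ]⇒ (f L + f (L +ₛ c)))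
  ∑ₛ-split {suc n} zero f = begin
    ∑ₛ f                                                       ≈⟨ ∑ₛ-suc f ⟩
    ∑ₛ (λ S → f (outside ∷ S)) + ∑ₛ (λ S → f (inside ∷ S))    ≈⟨ sumL-+ (allSubsets n) _ _ ⟨
    ∑ₛ (λ S → f (outside ∷ S) + f (inside ∷ S))               ≈⟨ +-identityʳ _ ⟨
    ∑ₛ (λ S → f (outside ∷ S) + f (inside ∷ S)) + 0#          ≈⟨ +-congˡ (∑ₛ-0 {n} (λ _ → refl)) ⟨
    ∑ₛ (λ S → f (outside ∷ S) + f (inside ∷ S)) + ∑ₛ {n} (λ _ → 0#) ≈⟨ ∑ₛ-suc {n} _ ⟨
    ∑ₛ (λ L → [ ¬? (zero ∈? L) ]⇒ (f L + f (L +ₛ zero)))      ∎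
  ∑ₛ-split {suc n} (suc c) f = begin
    ∑ₛ f                                                        ≈⟨ ∑ₛ-suc f ⟩
    ∑ₛ (λ S → f (outside ∷ S)) + ∑ₛ (λ S → f (inside ∷ S))     ≈⟨ +-cong (∑ₛ-split c _) (∑ₛ-split c _) ⟩
    ∑ₛ (λ S → [ ¬? (c ∈? S) ]⇒ (f (outside ∷ S) + f (outside ∷ (S +ₛ c))))
      + ∑ₛ (λ S → [ ¬? (c ∈? S) ]⇒ (f (inside ∷ S) + f (inside ∷ (S +ₛ c))))
                                                                ≈⟨ ∑ₛ-suc {n} _ ⟨
    ∑ₛ (λ L → [ ¬? (suc c ∈? L) ]⇒ (f L + f (L +ₛ suc c)))     ∎

  ∑ₛ-cancel : {f g : Subset n → Carrier} → (∀ S → g S ≈ - f S) → ∑ₛ f + ∑ₛ g ≈ 0#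
  ∑ₛ-cancel {f = f} g≈-f = trans (+-congˡ (trans (∑ₛ-cong g≈-f) (sym (sumL-neg (allSubsets _) f)))) (-‿inverseʳ _)

  []⇒-∑ₛ : {P : Subset n → Set p} (e : Dec Q) (d : ∀ K → Dec (P K)) (f : Subset n → Carrier) →
           [ e ]⇒ ∑ₛ (λ K → [ d K ]⇒ f K) ≈ ∑ₛ (λ K → [ d K ×-dec e ]⇒ f K)
  []⇒-∑ₛ (no ¬q) d f = sym (∑ₛ-0 (λ K → reflexive ([]⇒-no (d K ×-dec no ¬q) (¬q ∘ proj₂))))
  []⇒-∑ₛ (yes q) d f = ∑ₛ-cong (λ K → reflexive (≡.sym ([]⇒-yes-× (d K))))
    where
    []⇒-yes-× : (d : Dec P) → [ d ×-dec yes q ]⇒ x ≡ [ d ]⇒ x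
    []⇒-yes-× (yes _) = ≡.refl
    []⇒-yes-× (no _)  = ≡.refl

  ∑ₛ-interchange : {P : Subset n → Set p} {Q : Subset n → Subset n → Set q}
    (e : ∀ K → Dec (P K)) (d : ∀ K J → Dec (Q K J)) (u : Subset n → Subset n → Carrier) (f : Subset n → Carrier) →
    ∑ₛ (λ K → [ e K ]⇒ ∑ₛ (λ J → [ d K J ]⇒ (u K J * f J))) ≈ ∑ₛ (λ J → ∑ₛ (λ K → [ d K J ×-dec e K ]⇒ u K J) * f J)
  ∑ₛ-interchange {n} e d u f = begin
    ∑ₛ (λ K → [ e K ]⇒ ∑ₛ (λ J → [ d K J ]⇒ (u K J * f J)))   ≈⟨ ∑ₛ-cong (λ K → []⇒-∑ₛ (e K) (d K) _) ⟩
    ∑ₛ (λ K → ∑ₛ (λ J → [ d K J ×-dec e K ]⇒ (u K J * f J)))   ≈⟨ ∑ₛ-cong (λ K → ∑ₛ-cong (λ J → sym ([]⇒-*ˡ (d K J ×-dec e K)))) ⟩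
    ∑ₛ (λ K → ∑ₛ (λ J → [ d K J ×-dec e K ]⇒ u K J * f J))     ≈⟨ sumL-comm (allSubsets n) (allSubsets n) _ ⟩
    ∑ₛ (λ J → ∑ₛ (λ K → [ d K J ×-dec e K ]⇒ u K J * f J))     ≈⟨ ∑ₛ-cong {n = n} (λ J → sym (sumL-*ʳ (allSubsets n) _)) ⟩
    ∑ₛ (λ J → ∑ₛ (λ K → [ d K J ×-dec e K ]⇒ u K J) * f J)     ∎

  ∑ₛ-delta-* : (P : Subset n) (f : Subset n → Carrier) → ∑ₛ (λ J → [ J ≟S P ]⇒ 1# * f J) ≈ f P
  ∑ₛ-delta-* P f = trans (∑ₛ-cong (λ J → []⇒1#-* (J ≟S P))) (∑ₛ-delta P f)

  -- Möbius inversion on the subset lattice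
  ζ : (Subset n → Carrier) → Subset n → Carrier
  ζ f B = ∑ₛ λ K → [ K ⊆? B ]⇒ f K

  sign : Subset n → Subset n → Carrier
  sign R K = neg1^ ∣ R ─ K ∣

  μ : (Subset n → Carrier) → Subset n → Carrier
  μ g R = ∑ₛ λ K → [ K ⊆? R ]⇒ (sign R K * g K)

  private
    inside⊈outside : {p q : Subset n} → ¬ (inside ∷ p ⊆ outside ∷ q)
    inside⊈outside p⊆q with () ← p⊆q here

    left-half : {f g : Subset n → Carrier} → ∑ₛ f ≈ x → (∀ S → g S ≈ 0#) → ∑ₛ f + ∑ₛ g ≈ x
    left-half f≈x g≈0 = trans (+-cong f≈x (∑ₛ-0 g≈0)) (+-identityʳ _)

    right-half : {f g : Subset n → Carrier} → (∀ S → f S ≈ 0#) → ∑ₛ g ≈ x → ∑ₛ f + ∑ₛ g ≈ x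
    right-half f≈0 g≈x = trans (+-cong (∑ₛ-0 f≈0) g≈x) (+-identityˡ _)

    sign-flip : (d : Dec P) (k : ℕ) → [ d ]⇒ neg1^ (suc k) ≈ - [ d ]⇒ neg1^ k
    sign-flip d k = trans ([]⇒-cong d (λ _ → -1*x≈-x _)) (sym ([]⇒-neg d))

    vanish : (d : Dec P) (e : Dec Q) → ¬ Q → [ d ×-dec e ]⇒ x ≈ 0#
    vanish d e ¬Q = reflexive ([]⇒-no (d ×-dec e) (¬Q ∘ proj₂))

  ∑ₛ-sign-above : (K B : Subset n) → ∑ₛ (λ R → [ (K ⊆? R) ×-dec (R ⊆? B) ]⇒ sign R K) ≈ [ K ≟S B ]⇒ 1#
  ∑ₛ-sign-above []            []            = +-identityʳ _
  ∑ₛ-sign-above {suc n} (outside ∷ K) (outside ∷ B) =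
    trans (∑ₛ-suc {n} _) (left-half {n = n} (∑ₛ-sign-above K B) (λ R → vanish (K ⊆? R) (inside ∷ R ⊆? outside ∷ B) inside⊈outside))
  ∑ₛ-sign-above {suc n} (outside ∷ K) (inside ∷ B) =
    trans (∑ₛ-suc {n} _) (∑ₛ-cancel (λ R → sign-flip ((K ⊆? R) ×-dec (R ⊆? B)) ∣ R ─ K ∣))
  ∑ₛ-sign-above {suc n} (inside ∷ K) (outside ∷ B) =
    trans (∑ₛ-suc {n} _) (right-half {n = n} (λ _ → refl) (∑ₛ-0 (λ R → vanish (K ⊆? R) (inside ∷ R ⊆? outside ∷ B) inside⊈outside)))
  ∑ₛ-sign-above {suc n} (inside ∷ K) (inside ∷ B) =
    trans (∑ₛ-suc {n} _) (right-half {n = n} (λ _ → refl) (∑ₛ-sign-above K B))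

  ∑ₛ-sign-below : (J R : Subset n) → ∑ₛ (λ K → [ (J ⊆? K) ×-dec (K ⊆? R) ]⇒ sign R K) ≈ [ J ≟S R ]⇒ 1#
  ∑ₛ-sign-below []            []            = +-identityʳ _
  ∑ₛ-sign-below {suc n} (outside ∷ J) (outside ∷ R) =
    trans (∑ₛ-suc {n} _) (left-half {n = n} (∑ₛ-sign-below J R) (λ K → vanish (J ⊆? K) (inside ∷ K ⊆? outside ∷ R) inside⊈outside))
  ∑ₛ-sign-below {suc n} (outside ∷ J) (inside ∷ R) =
    trans (∑ₛ-suc {n} _) (trans (+-comm _ _) (∑ₛ-cancel (λ K → sign-flip ((J ⊆? K) ×-dec (K ⊆? R)) ∣ R ─ K ∣)))
  ∑ₛ-sign-below {suc n} (inside ∷ J) (outside ∷ R) =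
    trans (∑ₛ-suc {n} _) (right-half {n = n} (λ _ → refl) (∑ₛ-0 (λ K → vanish (J ⊆? K) (inside ∷ K ⊆? outside ∷ R) inside⊈outside)))
  ∑ₛ-sign-below {suc n} (inside ∷ J) (inside ∷ R) =
    trans (∑ₛ-suc {n} _) (right-half {n = n} (λ _ → refl) (∑ₛ-sign-below J R))

  μ∘ζ : (f : Subset n → Carrier) (R : Subset n) → μ (ζ f) R ≈ f R
  μ∘ζ {n} f R = begin
    ∑ₛ (λ K → [ K ⊆? R ]⇒ (sign R K * ζ f K))
      ≈⟨ ∑ₛ-cong (λ K → []⇒-cong (K ⊆? R) (λ _ → trans (sumL-*ˡ (allSubsets n) _) (∑ₛ-cong (λ J → []⇒-*ʳ (J ⊆? K))))) ⟩
    ∑ₛ (λ K → [ K ⊆? R ]⇒ ∑ₛ (λ J → [ J ⊆? K ]⇒ (sign R K * f J)))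
      ≈⟨ ∑ₛ-interchange (_⊆? R) (λ K J → J ⊆? K) (λ K _ → sign R K) f ⟩
    ∑ₛ (λ J → ∑ₛ (λ K → [ (J ⊆? K) ×-dec (K ⊆? R) ]⇒ sign R K) * f J)
      ≈⟨ ∑ₛ-cong (λ J → *-congʳ (∑ₛ-sign-below J R)) ⟩
    ∑ₛ (λ J → [ J ≟S R ]⇒ 1# * f J)
      ≈⟨ ∑ₛ-delta-* R f ⟩
    f R ∎

  ζ∘μ : (g : Subset n → Carrier) (B : Subset n) → ζ (μ g) B ≈ g B
  ζ∘μ g B = begin
    ∑ₛ (λ R → [ R ⊆? B ]⇒ ∑ₛ (λ K → [ K ⊆? R ]⇒ (sign R K * g K)))
      ≈⟨ ∑ₛ-interchange (_⊆? B) (λ R K → K ⊆? R) sign g ⟩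
    ∑ₛ (λ K → ∑ₛ (λ R → [ (K ⊆? R) ×-dec (R ⊆? B) ]⇒ sign R K) * g K)
      ≈⟨ ∑ₛ-cong (λ K → *-congʳ (∑ₛ-sign-above K B)) ⟩
    ∑ₛ (λ K → [ K ≟S B ]⇒ 1# * g K)
      ≈⟨ ∑ₛ-delta-* B g ⟩
    g B ∎

  ζ-cong : {f g : Subset n → Carrier} (B : Subset n) → (∀ K → K ⊆ B → f K ≈ g K) → ζ f B ≈ ζ g B
  ζ-cong B f≈g = ∑ₛ-cong (λ K → []⇒-cong (K ⊆? B) (f≈g K))

  μ-cong : {f g : Subset n → Carrier} (R : Subset n) → (∀ K → K ⊆ R → f K ≈ g K) → μ f R ≈ μ g R
  μ-cong R f≈g = ∑ₛ-cong (λ K → []⇒-cong (K ⊆? R) (*-congˡ ∘ f≈g K))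

  μ-+ₛ : (g : Subset n → Carrier) {M : Subset n} {c : Fin n} → c ∉ M →
         μ g (M +ₛ c) ≈ μ (λ L → g (L +ₛ c) - g L) M
  μ-+ₛ {n} g {M} {c} c∉M = trans (∑ₛ-split c _) (∑ₛ-cong pair)
    where
    term : Subset n → Carrier
    term K = [ K ⊆? M +ₛ c ]⇒ (sign (M +ₛ c) K * g K)

    without-c : ∀ {L} → c ∉ L → term L ≈ [ L ⊆? M ]⇒ (- (sign M L * g L))
    without-c {L} c∉L = begin
      term L                                                   ≡⟨ []⇒-⇔ (⊆-+ₛ⇔ c∉L) (L ⊆? M +ₛ c) (L ⊆? M) ⟩
      [ L ⊆? M ]⇒ (neg1^ ∣ M +ₛ c ─ L ∣ * g L)               ≡⟨ ≡.cong (λ k → [ L ⊆? M ]⇒ (neg1^ k * g L)) (∣+ₛ─∣ c∉L c∉M) ⟩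
      [ L ⊆? M ]⇒ ((- 1# * sign M L) * g L)                   ≈⟨ []⇒-cong (L ⊆? M) (λ _ → trans (*-assoc _ _ _) (-1*x≈-x _)) ⟩
      [ L ⊆? M ]⇒ (- (sign M L * g L))                         ∎

    with-c : ∀ {L} → c ∉ L → term (L +ₛ c) ≈ [ L ⊆? M ]⇒ (sign M L * g (L +ₛ c))
    with-c {L} c∉L = begin
      term (L +ₛ c)                                            ≡⟨ []⇒-⇔ (+ₛ-⊆-+ₛ⇔ c∉L) (L +ₛ c ⊆? M +ₛ c) (L ⊆? M) ⟩
      [ L ⊆? M ]⇒ (sign (M +ₛ c) (L +ₛ c) * g (L +ₛ c))      ≡⟨ ≡.cong (λ k → [ L ⊆? M ]⇒ (neg1^ k * g (L +ₛ c))) (∣+ₛ─+ₛ∣ c∉M) ⟩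
      [ L ⊆? M ]⇒ (sign M L * g (L +ₛ c))                     ∎

    pair : ∀ L → [ ¬? (c ∈? L) ]⇒ (term L + term (L +ₛ c)) ≈ [ L ⊆? M ]⇒ (sign M L * (g (L +ₛ c) - g L))
    pair L with c ∈? L
    ... | yes c∈L = sym (reflexive ([]⇒-no (L ⊆? M) (λ L⊆M → c∉M (L⊆M c∈L))))
    ... | no  c∉L = begin
      term L + term (L +ₛ c)                                            ≈⟨ +-cong (without-c c∉L) (with-c c∉L) ⟩
      [ L ⊆? M ]⇒ (- (sign M L * g L)) + [ L ⊆? M ]⇒ (sign M L * g (L +ₛ c)) ≈⟨ []⇒-+ (L ⊆? M) ⟩
      [ L ⊆? M ]⇒ (- (sign M L * g L) + sign M L * g (L +ₛ c))
        ≈⟨ []⇒-cong (L ⊆? M) (λ _ → trans (+-comm _ _) (sym (x[y-z]≈xy-xz _ _ _))) ⟩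
      [ L ⊆? M ]⇒ (sign M L * (g (L +ₛ c) - g L))                        ∎

  ζ-⊥ : (f : Subset n → Carrier) → ζ f ⊥ ≈ f ⊥
  ζ-⊥ {n} f = trans (∑ₛ-cong {n = n} (λ K → reflexive ([]⇒-⇔ ⊆⊥⇔≡⊥ (K ⊆? ⊥) (K ≟S ⊥)))) (∑ₛ-delta ⊥ f)

  μ-⊥ : (g : Subset n → Carrier) → μ g ⊥ ≈ g ⊥
  μ-⊥ {n} g = begin
    μ g ⊥                          ≈⟨ ζ-⊥ (λ K → sign ⊥ K * g K) ⟩
    neg1^ ∣ ⊥ {n} ─ ⊥ ∣ * g ⊥      ≡⟨ ≡.cong (λ k → neg1^ k * g ⊥) (≡.trans (≡.cong ∣_∣ (p─⊥≡p (⊥ {n}))) (∣⊥∣≡0 n)) ⟩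
    1# * g ⊥                       ≈⟨ *-identityˡ _ ⟩
    g ⊥                            ∎

  -- Local scores and score equivalence
  -- localScore extends o by 0 outside Υ; this is the convention o(b|∅) = 0.
  localScore : VecΥ n → Fin n → Subset n → Carrier
  localScore o a B = [ inΥ? a B ]⇒ o a B

  []⇒-inΥ-∉ : {a : Fin n} {K : Subset n} → a ∉ K → [ inΥ? a K ]⇒ x ≡ [ nonempty? K ]⇒ x
  []⇒-inΥ-∉ {a = a} {K} a∉K = ≡.trans ([]⇒-× (¬? (a ∈? K)) (nonempty? K)) ([]⇒-yes (¬? (a ∈? K)) a∉K)

  []⇒-inΥ-⊥ : (a : Fin n) → [ inΥ? a ⊥ ]⇒ x ≡ 0#
  []⇒-inΥ-⊥ a = []⇒-no (inΥ? a ⊥) (λ { (_ , (_ , x∈⊥)) → ∉⊥ x∈⊥ })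

  score-ηvec : (o : VecΥ n) (G : DAG n) → ⟨ o , ηvec G ⟩Υ ≈ ∑ᶠ (λ a → localScore o a (pa G a))
  score-ηvec o G = ∑ᶠ-cong λ a → trans (∑ₛ-cong (λ B → term a B)) (∑ₛ-delta (pa G a) (localScore o a))
    where
    term : ∀ a B → [ inΥ? a B ]⇒ (o a B * ηvec G a B) ≈ [ B ≟S pa G a ]⇒ localScore o a B
    term a B = begin
      [ inΥ? a B ]⇒ (o a B * [ B ≟S pa G a ]⇒ 1#)     ≈⟨ []⇒-cong (inΥ? a B) (λ _ → *-[]⇒1# (B ≟S pa G a)) ⟩
      [ inΥ? a B ]⇒ ([ B ≟S pa G a ]⇒ o a B)          ≡⟨ []⇒-comm (inΥ? a B) (B ≟S pa G a) ⟩
      [ B ≟S pa G a ]⇒ localScore o a B                 ∎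

  module _ {n} (o : VecΥ n) {b c : Fin n} (b≢c : b ≢ c) {M : Subset n} (b∉M : b ∉ M) (c∉M : c ∉ M) where
    open Cover b≢c b∉M c∉M

    score-cover : ⟨ o , ηvec graph ⟩Υ ≈ localScore o b M + localScore o c (M +ₛ b)
    score-cover = begin
      ⟨ o , ηvec graph ⟩Υ                                   ≈⟨ score-ηvec o graph ⟩
      ∑ᶠ (λ a → localScore o a (pa graph a))                ≈⟨ ∑ᶠ-cong (λ a → reflexive (≡.cong (localScore o a) (pa-graph a))) ⟩
      ∑ᶠ (λ a → localScore o a (parents a))                 ≈⟨ ∑ᶠ-cong node ⟩
      ∑ᶠ (λ a → [ a ≟ b ]⇒ localScore o b M + [ a ≟ c ]⇒ localScore o c (M +ₛ b))
                                                            ≈⟨ sumL-+ (allFin n) _ _ ⟩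
      ∑ᶠ (λ a → [ a ≟ b ]⇒ localScore o b M) + ∑ᶠ (λ a → [ a ≟ c ]⇒ localScore o c (M +ₛ b))
                                                            ≈⟨ +-cong (∑ᶠ-delta b _) (∑ᶠ-delta c _) ⟩
      localScore o b M + localScore o c (M +ₛ b)            ∎
      where
      node : ∀ a → localScore o a (parents a) ≈ [ a ≟ b ]⇒ localScore o b M + [ a ≟ c ]⇒ localScore o c (M +ₛ b)
      node a with role b c a
      ... | is-b = begin
        localScore o b (parents b)                     ≡⟨ ≡.cong (localScore o b) parents-b ⟩
        localScore o b M                               ≈⟨ +-identityʳ _ ⟨
        localScore o b M + 0#                          ≡⟨ ≡.cong₂ _+_ ([]⇒-yes (b ≟ b) ≡.refl) ([]⇒-no (b ≟ c) b≢c) ⟨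
        [ b ≟ b ]⇒ localScore o b M + [ b ≟ c ]⇒ localScore o c (M +ₛ b) ∎
      ... | is-c = begin
        localScore o c (parents c)                     ≡⟨ ≡.cong (localScore o c) parents-c ⟩
        localScore o c (M +ₛ b)                        ≈⟨ +-identityˡ _ ⟨
        0# + localScore o c (M +ₛ b)                   ≡⟨ ≡.cong₂ _+_ ([]⇒-no (c ≟ b) (b≢c ∘ ≡.sym)) ([]⇒-yes (c ≟ c) ≡.refl) ⟨
        [ c ≟ b ]⇒ localScore o b M + [ c ≟ c ]⇒ localScore o c (M +ₛ b) ∎
      ... | neither a≢b a≢c = begin
        localScore o a (parents a)                     ≡⟨ ≡.trans (≡.cong (localScore o a) (parents-neither a≢b a≢c)) ([]⇒-inΥ-⊥ a) ⟩
        0#                                             ≈⟨ +-identityˡ 0# ⟨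
        0# + 0#                                        ≡⟨ ≡.cong₂ _+_ ([]⇒-no (a ≟ b) a≢b) ([]⇒-no (a ≟ c) a≢c) ⟨
        [ a ≟ b ]⇒ localScore o b M + [ a ≟ c ]⇒ localScore o c (M +ₛ b) ∎

  score-exchange : {o : VecΥ n} → IsSE o → {b c : Fin n} → b ≢ c → {M : Subset n} → b ∉ M → c ∉ M →
                   localScore o b M + localScore o c (M +ₛ b) ≈ localScore o c M + localScore o b (M +ₛ c)
  score-exchange {n} {o = o} se {b} {c} b≢c {M} b∉M c∉M = begin
    localScore o b M + localScore o c (M +ₛ b)  ≈⟨ score-cover o b≢c b∉M c∉M ⟨
    ⟨ o , ηvec G ⟩Υ                             ≈⟨ se G H (covered-reversal-∼ (cover-reversal b≢c b∉M c∉M)) ⟩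
    ⟨ o , ηvec H ⟩Υ                             ≈⟨ score-cover o (b≢c ∘ ≡.sym) c∉M b∉M ⟩
    localScore o c M + localScore o b (M +ₛ c)  ∎
    where
    G H : DAG n
    G = Cover.graph b≢c b∉M c∉M
    H = Cover.graph (b≢c ∘ ≡.sym) c∉M b∉M

  private
    exchange-difference : ∀ {x y z w} → x + y ≈ z + w → w - x ≈ y - z
    exchange-difference {x} {y} {z} {w} x+y≈z+w = begin
      w - x                  ≈⟨ +-identityʳ _ ⟨
      (w - x) + 0#           ≈⟨ +-congˡ (-‿inverseʳ z) ⟨
      (w - x) + (z - z)      ≈⟨ solve 4 (λ w -x z -z → (w ⊕ -x) ⊕ (z ⊕ -z) ⊜ ((z ⊕ w) ⊕ -x) ⊕ -z) refl w (- x) z (- z) ⟩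
      ((z + w) - x) - z      ≈⟨ +-congʳ (+-congʳ x+y≈z+w) ⟨
      ((x + y) - x) - z      ≈⟨ solve 4 (λ x y -x -z → ((x ⊕ y) ⊕ -x) ⊕ -z ⊜ (y ⊕ -z) ⊕ (x ⊕ -x)) refl x y (- x) (- z) ⟩
      (y - z) + (x - x)      ≈⟨ +-congˡ (-‿inverseʳ x) ⟩
      (y - z) + 0#           ≈⟨ +-identityʳ _ ⟩
      y - z                  ∎
      where open import Algebra.Solver.CommutativeMonoid +-commutativeMonoid using (solve; _⊕_; _⊜_)

  μ-localScore-independent : {o : VecΥ n} → IsSE o → {T : Subset n} {b c : Fin n} → b ∈ T → c ∈ T →
                             μ (localScore o b) (T ∖ₛ b) ≈ μ (localScore o c) (T ∖ₛ c)
  μ-localScore-independent {o = o} se {T} {b} {c} b∈T c∈T with b ≟ c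
  ... | yes ≡.refl = refl
  ... | no b≢c = begin
    μ (localScore o b) (T ∖ₛ b)        ≡⟨ ≡.cong (μ (localScore o b)) (≡.sym (∖ₛ-+ₛ (∈-∖ₛ⁺ (b≢c ∘ ≡.sym) c∈T))) ⟩
    μ (localScore o b) (M +ₛ c)        ≈⟨ μ-+ₛ (localScore o b) c∉M ⟩
    μ (λ L → localScore o b (L +ₛ c) - localScore o b L) M
                                       ≈⟨ μ-cong M (λ L L⊆M → exchange-difference (score-exchange se b≢c (b∉M ∘ L⊆M) (c∉M ∘ L⊆M))) ⟩
    μ (λ L → localScore o c (L +ₛ b) - localScore o c L) M
                                       ≈⟨ μ-+ₛ (localScore o c) b∉M ⟨
    μ (localScore o c) (M +ₛ b)        ≡⟨ ≡.cong (μ (localScore o c)) (≡.trans (≡.cong (_+ₛ b) M≡) (∖ₛ-+ₛ (∈-∖ₛ⁺ b≢c b∈T))) ⟩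
    μ (localScore o c) (T ∖ₛ c)        ∎
    where
    M = T ∖ₛ b ∖ₛ c
    M≡ : M ≡ T ∖ₛ c ∖ₛ b
    M≡ = p─q─r≡p─r─q T ⁅ b ⁆ ⁅ c ⁆
    c∉M : c ∉ M
    c∉M = ∉-∖ₛ (T ∖ₛ b) c
    b∉M : b ∉ M
    b∉M = ≡.subst (b ∉_) (≡.sym M≡) (∉-∖ₛ (T ∖ₛ c) b)

  -- The coefficients τ_o
  formula≈μ : (o : VecΥ n) (T : Subset n) (b : Fin n) → formula o T b ≈ μ (localScore o b) (T ∖ₛ b)
  formula≈μ o T b = ∑ₛ-cong term
    where
    term : ∀ K → [ (K ⊆? T ∖ₛ b) ×-dec nonempty? K ]⇒ (sign (T ∖ₛ b) K * o b K)
               ≈ [ K ⊆? T ∖ₛ b ]⇒ (sign (T ∖ₛ b) K * localScore o b K)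
    term K = trans (reflexive ([]⇒-× (K ⊆? T ∖ₛ b) (nonempty? K))) ([]⇒-cong (K ⊆? T ∖ₛ b) λ K⊆T∖b →
      trans (sym ([]⇒-*ʳ (nonempty? K))) (*-congˡ (reflexive (≡.sym ([]⇒-inΥ-∉ (∉-∖ₛ T b ∘ K⊆T∖b))))))

  τ : VecΥ n → VecΥc n
  τ o T with nonempty? T
  ... | yes (b , _) = formula o T b
  ... | no _        = 0#

  τ≈μ : {o : VecΥ n} → IsSE o → {T : Subset n} {b : Fin n} → b ∈ T → τ o T ≈ μ (localScore o b) (T ∖ₛ b)
  τ≈μ {o = o} se {T} {b} b∈T with nonempty? T
  ... | yes (b′ , b′∈T) = trans (formula≈μ o T b′) (μ-localScore-independent se b′∈T b∈T)
  ... | no T-empty      = contradiction (b , b∈T) T-empty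

  τ-formula : {o : VecΥ n} → IsSE o → {T : Subset n} {b : Fin n} → b ∈ T → τ o T ≈ formula o T b
  τ-formula {o = o} se {T} {b} b∈T = trans (τ≈μ se b∈T) (sym (formula≈μ o T b))

  -- The adjoint of η ↦ c_η
  private
    []⇒-*-sumL : (d : Dec P) (xs : List A) (f : A → Carrier) → [ d ]⇒ (x * sumL xs f) ≈ sumL xs (λ a → [ d ]⇒ (x * f a))
    []⇒-*-sumL d xs f = trans ([]⇒-cong d (λ _ → sumL-*ˡ xs f)) ([]⇒-sumL d xs _)

    []⇒-regroup : (p : Dec P) (q : Dec Q) (r : Dec U) (t : Dec V) →
                  [ p ]⇒ ([ q ]⇒ (x * [ r ]⇒ ([ t ]⇒ y))) ≈ [ r ]⇒ ([ p ×-dec (q ×-dec t) ]⇒ x * y)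
    []⇒-regroup (no _)  q       r       t       = sym (trans ([]⇒-cong r (λ _ → zeroˡ _)) (reflexive ([]⇒-0 r)))
    []⇒-regroup (yes _) (no _)  r       t       = sym (trans ([]⇒-cong r (λ _ → zeroˡ _)) (reflexive ([]⇒-0 r)))
    []⇒-regroup (yes _) (yes _) (no _)  t       = zeroʳ _
    []⇒-regroup (yes _) (yes _) (yes _) (no _)  = trans (zeroʳ _) (sym (zeroˡ _))
    []⇒-regroup (yes _) (yes _) (yes _) (yes _) = refl

  weight : VecΥc n → VecΥ n
  weight κ a B = ∑ₛ λ S → [ (2 ≤? ∣ S ∣) ×-dec ((a ∈? S) ×-dec (S ∖ₛ a ⊆? B)) ]⇒ κ S

  cvec-adjoint : (κ : VecΥc n) (η : VecΥ n) → ⟨ κ , cvec η ⟩Υc ≈ ⟨ weight κ , η ⟩Υ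
  cvec-adjoint {n} κ η = begin
    ∑ₛ (λ S → [ 2 ≤? ∣ S ∣ ]⇒ (κ S * ∑ᶠ (λ a → [ a ∈? S ]⇒ ∑ₛ (λ B → [ inΥ? a B ]⇒ ([ S ∖ₛ a ⊆? B ]⇒ η a B)))))
      ≈⟨ ∑ₛ-cong expand ⟩
    ∑ₛ (λ S → ∑ᶠ (λ a → ∑ₛ (λ B → [ inΥ? a B ]⇒ (coefficient S a B * η a B))))
      ≈⟨ sumL-comm (allSubsets n) (allFin n) _ ⟩
    ∑ᶠ (λ a → ∑ₛ (λ S → ∑ₛ (λ B → [ inΥ? a B ]⇒ (coefficient S a B * η a B))))
      ≈⟨ ∑ᶠ-cong {n = n} (λ a → sumL-comm (allSubsets n) (allSubsets n) _) ⟩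
    ∑ᶠ (λ a → ∑ₛ (λ B → ∑ₛ (λ S → [ inΥ? a B ]⇒ (coefficient S a B * η a B))))
      ≈⟨ ∑ᶠ-cong (λ a → ∑ₛ-cong (λ B → collect a B)) ⟩
    ∑ᶠ (λ a → ∑ₛ (λ B → [ inΥ? a B ]⇒ (weight κ a B * η a B)))
      ∎
    where
    coefficient : Subset n → Fin n → Subset n → Carrier
    coefficient S a B = [ (2 ≤? ∣ S ∣) ×-dec ((a ∈? S) ×-dec (S ∖ₛ a ⊆? B)) ]⇒ κ S

    expand : ∀ S → [ 2 ≤? ∣ S ∣ ]⇒ (κ S * ∑ᶠ (λ a → [ a ∈? S ]⇒ ∑ₛ (λ B → [ inΥ? a B ]⇒ ([ S ∖ₛ a ⊆? B ]⇒ η a B))))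
                 ≈ ∑ᶠ (λ a → ∑ₛ (λ B → [ inΥ? a B ]⇒ (coefficient S a B * η a B)))
    expand S = trans ([]⇒-*-sumL (2 ≤? ∣ S ∣) (allFin n) _) (∑ᶠ-cong λ a → begin
      [ 2 ≤? ∣ S ∣ ]⇒ (κ S * [ a ∈? S ]⇒ ∑ₛ (λ B → [ inΥ? a B ]⇒ ([ S ∖ₛ a ⊆? B ]⇒ η a B)))
        ≈⟨ []⇒-cong (2 ≤? ∣ S ∣) (λ _ → trans ([]⇒-*ʳ (a ∈? S)) ([]⇒-*-sumL (a ∈? S) (allSubsets n) _)) ⟩
      [ 2 ≤? ∣ S ∣ ]⇒ ∑ₛ (λ B → [ a ∈? S ]⇒ (κ S * [ inΥ? a B ]⇒ ([ S ∖ₛ a ⊆? B ]⇒ η a B)))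
        ≈⟨ []⇒-sumL (2 ≤? ∣ S ∣) (allSubsets n) _ ⟩
      ∑ₛ (λ B → [ 2 ≤? ∣ S ∣ ]⇒ ([ a ∈? S ]⇒ (κ S * [ inΥ? a B ]⇒ ([ S ∖ₛ a ⊆? B ]⇒ η a B))))
        ≈⟨ ∑ₛ-cong (λ B → []⇒-regroup (2 ≤? ∣ S ∣) (a ∈? S) (inΥ? a B) (S ∖ₛ a ⊆? B)) ⟩
      ∑ₛ (λ B → [ inΥ? a B ]⇒ (coefficient S a B * η a B))
        ∎)

    collect : ∀ a B → ∑ₛ (λ S → [ inΥ? a B ]⇒ (coefficient S a B * η a B)) ≈ [ inΥ? a B ]⇒ (weight κ a B * η a B)
    collect a B = trans (sym ([]⇒-sumL (inΥ? a B) (allSubsets n) _))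
                        ([]⇒-cong (inΥ? a B) (λ _ → sym (sumL-*ʳ (allSubsets n) _)))

  slice : VecΥc n → Fin n → Subset n → Carrier
  slice κ a L = [ inΥ? a L ]⇒ κ (L +ₛ a)

  weight≈ζ-slice : (κ : VecΥc n) (a : Fin n) (B : Subset n) → weight κ a B ≈ ζ (slice κ a) B
  weight≈ζ-slice {n} κ a B = trans (∑ₛ-split a _) (∑ₛ-cong term)
    where
    F : Subset n → Carrier
    F S = [ (2 ≤? ∣ S ∣) ×-dec ((a ∈? S) ×-dec (S ∖ₛ a ⊆? B)) ]⇒ κ S

    term : ∀ L → [ ¬? (a ∈? L) ]⇒ (F L + F (L +ₛ a)) ≈ [ L ⊆? B ]⇒ slice κ a L
    term L = []⇒-elim (¬? (a ∈? L)) without-a with-a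
      where
      with-a : ¬ (a ∉ L) → 0# ≈ [ L ⊆? B ]⇒ slice κ a L
      with-a a∈L = sym (reflexive (≡.trans (≡.cong ([ L ⊆? B ]⇒_) ([]⇒-no (inΥ? a L) (a∈L ∘ proj₁))) ([]⇒-0 (L ⊆? B))))

      without-a : a ∉ L → F L + F (L +ₛ a) ≈ [ L ⊆? B ]⇒ slice κ a L
      without-a a∉L = begin
        F L + F (L +ₛ a)
          ≈⟨ +-congʳ (reflexive ([]⇒-no ((2 ≤? ∣ L ∣) ×-dec ((a ∈? L) ×-dec (L ∖ₛ a ⊆? B))) (λ (_ , a∈L , _) → a∉L a∈L))) ⟩
        0# + F (L +ₛ a)
          ≈⟨ +-identityˡ _ ⟩
        F (L +ₛ a)
          ≡⟨ ≡.trans ([]⇒-× (2 ≤? ∣ L +ₛ a ∣) ((a ∈? L +ₛ a) ×-dec (L +ₛ a ∖ₛ a ⊆? B)))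
                      (≡.cong ([ 2 ≤? ∣ L +ₛ a ∣ ]⇒_) ([]⇒-× (a ∈? L +ₛ a) (L +ₛ a ∖ₛ a ⊆? B))) ⟩
        [ 2 ≤? ∣ L +ₛ a ∣ ]⇒ ([ a ∈? L +ₛ a ]⇒ ([ L +ₛ a ∖ₛ a ⊆? B ]⇒ κ (L +ₛ a)))
          ≡⟨ []⇒-⇔ (2≤∣+ₛ∣⇔Nonempty a∉L) (2 ≤? ∣ L +ₛ a ∣) (nonempty? L) ⟩
        [ nonempty? L ]⇒ ([ a ∈? L +ₛ a ]⇒ ([ L +ₛ a ∖ₛ a ⊆? B ]⇒ κ (L +ₛ a)))
          ≡⟨ ≡.cong ([ nonempty? L ]⇒_) ([]⇒-yes (a ∈? L +ₛ a) (∈-+ₛ L a)) ⟩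
        [ nonempty? L ]⇒ ([ L +ₛ a ∖ₛ a ⊆? B ]⇒ κ (L +ₛ a))
          ≡⟨ ≡.cong (λ X → [ nonempty? L ]⇒ ([ X ⊆? B ]⇒ κ (L +ₛ a))) (+ₛ-∖ₛ a∉L) ⟩
        [ nonempty? L ]⇒ ([ L ⊆? B ]⇒ κ (L +ₛ a))
          ≡⟨ []⇒-comm (nonempty? L) (L ⊆? B) ⟩
        [ L ⊆? B ]⇒ ([ nonempty? L ]⇒ κ (L +ₛ a))
          ≡⟨ ≡.cong ([ L ⊆? B ]⇒_) ([]⇒-inΥ-∉ a∉L) ⟨
        [ L ⊆? B ]⇒ slice κ a L
          ∎

  weight-τ≈o : {o : VecΥ n} → IsSE o → {a : Fin n} {B : Subset n} → a ∉ B → Nonempty B → weight (τ o) a B ≈ o a B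
  weight-τ≈o {o = o} se {a} {B} a∉B B≠∅ = begin
    weight (τ o) a B                  ≈⟨ weight≈ζ-slice (τ o) a B ⟩
    ζ (slice (τ o) a) B               ≈⟨ ζ-cong B (λ L L⊆B → slice-τ (a∉B ∘ L⊆B)) ⟩
    ζ (μ (localScore o a)) B          ≈⟨ ζ∘μ (localScore o a) B ⟩
    localScore o a B                  ≡⟨ []⇒-yes (inΥ? a B) (a∉B , B≠∅) ⟩
    o a B                             ∎
    where
    slice-τ : ∀ {L} → a ∉ L → slice (τ o) a L ≈ μ (localScore o a) L
    slice-τ {L} a∉L = by-cases (nonempty? L) nonempty (λ L=∅ → ≡.subst (λ L → slice (τ o) a L ≈ μ (localScore o a) L)
                                                                    (≡.sym (Empty-unique L=∅)) empty)
      where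
      nonempty : Nonempty L → slice (τ o) a L ≈ μ (localScore o a) L
      nonempty L≠∅ = begin
        slice (τ o) a L                    ≡⟨ []⇒-yes (inΥ? a L) (a∉L , L≠∅) ⟩
        τ o (L +ₛ a)                       ≈⟨ τ≈μ se (∈-+ₛ L a) ⟩
        μ (localScore o a) (L +ₛ a ∖ₛ a)   ≡⟨ ≡.cong (μ (localScore o a)) (+ₛ-∖ₛ a∉L) ⟩
        μ (localScore o a) L               ∎
      empty : slice (τ o) a ⊥ ≈ μ (localScore o a) ⊥
      empty = begin
        slice (τ o) a ⊥                    ≡⟨ []⇒-inΥ-⊥ a ⟩
        0#                                 ≡⟨ []⇒-inΥ-⊥ a ⟨
        localScore o a ⊥                   ≈⟨ μ-⊥ (localScore o a) ⟨
        μ (localScore o a) ⊥               ∎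

  weight-determines : {o : VecΥ n} {κ : VecΥc n} → (∀ {a B} → a ∉ B → Nonempty B → weight κ a B ≈ o a B) →
                      {T : Subset n} {a : Fin n} → a ∈ T → 2 ≤ ∣ T ∣ → κ T ≈ μ (localScore o a) (T ∖ₛ a)
  weight-determines {o = o} {κ} weight≈o {T} {a} a∈T 2≤∣T∣ = begin
    κ T                                    ≡⟨ ≡.cong κ (∖ₛ-+ₛ a∈T) ⟨
    κ (T ∖ₛ a +ₛ a)                        ≡⟨ []⇒-yes (inΥ? a (T ∖ₛ a)) (a∉T∖a , T∖a≠∅) ⟨
    slice κ a (T ∖ₛ a)                     ≈⟨ μ∘ζ (slice κ a) (T ∖ₛ a) ⟨
    μ (ζ (slice κ a)) (T ∖ₛ a)             ≈⟨ μ-cong (T ∖ₛ a) (λ K K⊆T∖a → ζ-slice (a∉T∖a ∘ K⊆T∖a)) ⟩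
    μ (localScore o a) (T ∖ₛ a)            ∎
    where
    a∉T∖a : a ∉ T ∖ₛ a
    a∉T∖a = ∉-∖ₛ T a
    T∖a≠∅ : Nonempty (T ∖ₛ a)
    T∖a≠∅ = Equivalence.to (2≤∣+ₛ∣⇔Nonempty a∉T∖a) (≡.subst (λ S → 2 ≤ ∣ S ∣) (≡.sym (∖ₛ-+ₛ a∈T)) 2≤∣T∣)

    ζ-slice : ∀ {K} → a ∉ K → ζ (slice κ a) K ≈ localScore o a K
    ζ-slice {K} a∉K = by-cases (nonempty? K) nonempty (λ K=∅ → ≡.subst (λ K → ζ (slice κ a) K ≈ localScore o a K)
                                                                    (≡.sym (Empty-unique K=∅)) empty)
      where
      nonempty : Nonempty K → ζ (slice κ a) K ≈ localScore o a K
      nonempty K≠∅ = begin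
        ζ (slice κ a) K                    ≈⟨ weight≈ζ-slice κ a K ⟨
        weight κ a K                       ≈⟨ weight≈o a∉K K≠∅ ⟩
        o a K                              ≡⟨ []⇒-yes (inΥ? a K) (a∉K , K≠∅) ⟨
        localScore o a K                   ∎
      empty : ζ (slice κ a) ⊥ ≈ localScore o a ⊥
      empty = begin
        ζ (slice κ a) ⊥                    ≈⟨ ζ-⊥ (slice κ a) ⟩
        slice κ a ⊥                        ≡⟨ ≡.trans ([]⇒-inΥ-⊥ a) (≡.sym ([]⇒-inΥ-⊥ a)) ⟩
        localScore o a ⊥                   ∎

  indicator : Fin n → Subset n → VecΥ n
  indicator a₀ B₀ a B = [ (a ≟ a₀) ×-dec (B ≟S B₀) ]⇒ 1#

  pairing-indicator : (X : VecΥ n) (a₀ : Fin n) (B₀ : Subset n) → ⟨ X , indicator a₀ B₀ ⟩Υ ≈ [ inΥ? a₀ B₀ ]⇒ X a₀ B₀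
  pairing-indicator {n} X a₀ B₀ = begin
    ∑ᶠ (λ a → ∑ₛ (λ B → [ inΥ? a B ]⇒ (X a B * indicator a₀ B₀ a B)))
      ≈⟨ ∑ᶠ-cong (λ a → ∑ₛ-cong (term a)) ⟩
    ∑ᶠ (λ a → ∑ₛ (λ B → [ a ≟ a₀ ]⇒ ([ B ≟S B₀ ]⇒ ([ inΥ? a B ]⇒ X a B))))
      ≈⟨ ∑ᶠ-cong (λ a → trans (sym ([]⇒-sumL (a ≟ a₀) (allSubsets n) _)) ([]⇒-cong (a ≟ a₀) (λ _ → ∑ₛ-delta B₀ _))) ⟩
    ∑ᶠ (λ a → [ a ≟ a₀ ]⇒ ([ inΥ? a B₀ ]⇒ X a B₀))
      ≈⟨ ∑ᶠ-delta a₀ _ ⟩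
    [ inΥ? a₀ B₀ ]⇒ X a₀ B₀ ∎
    where
    term : ∀ a B → [ inΥ? a B ]⇒ (X a B * indicator a₀ B₀ a B) ≈ [ a ≟ a₀ ]⇒ ([ B ≟S B₀ ]⇒ ([ inΥ? a B ]⇒ X a B))
    term a B = begin
      [ inΥ? a B ]⇒ (X a B * indicator a₀ B₀ a B)
        ≈⟨ []⇒-cong (inΥ? a B) (λ _ → *-[]⇒1# ((a ≟ a₀) ×-dec (B ≟S B₀))) ⟩
      [ inΥ? a B ]⇒ ([ (a ≟ a₀) ×-dec (B ≟S B₀) ]⇒ X a B)
        ≡⟨ ≡.trans ([]⇒-comm (inΥ? a B) ((a ≟ a₀) ×-dec (B ≟S B₀))) ([]⇒-× (a ≟ a₀) (B ≟S B₀)) ⟩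
      [ a ≟ a₀ ]⇒ ([ B ≟S B₀ ]⇒ ([ inΥ? a B ]⇒ X a B))
        ∎

  weight-from-pairing : {o : VecΥ n} {κ : VecΥc n} → (∀ η → ⟨ o , η ⟩Υ ≈ ⟨ κ , cvec η ⟩Υc) →
                        ∀ {a B} → a ∉ B → Nonempty B → weight κ a B ≈ o a B
  weight-from-pairing {o = o} {κ} represents {a} {B} a∉B B≠∅ = begin
    weight κ a B                              ≡⟨ []⇒-yes (inΥ? a B) (a∉B , B≠∅) ⟨
    [ inΥ? a B ]⇒ weight κ a B                ≈⟨ pairing-indicator (weight κ) a B ⟨
    ⟨ weight κ , indicator a B ⟩Υ             ≈⟨ cvec-adjoint κ (indicator a B) ⟨
    ⟨ κ , cvec (indicator a B) ⟩Υc            ≈⟨ represents (indicator a B) ⟨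
    ⟨ o , indicator a B ⟩Υ                    ≈⟨ pairing-indicator o a B ⟩
    [ inΥ? a B ]⇒ o a B                       ≡⟨ []⇒-yes (inΥ? a B) (a∉B , B≠∅) ⟩
    o a B                                     ∎

  pairing-from-weight : {o : VecΥ n} {κ : VecΥc n} → (∀ {a B} → a ∉ B → Nonempty B → weight κ a B ≈ o a B) →
                        ∀ η → ⟨ o , η ⟩Υ ≈ ⟨ κ , cvec η ⟩Υc
  pairing-from-weight {κ = κ} weight≈o η = sym (trans (cvec-adjoint κ η)
    (∑ᶠ-cong λ a → ∑ₛ-cong λ B → []⇒-cong (inΥ? a B) (λ (a∉B , B≠∅) → *-congʳ (weight≈o a∉B B≠∅))))

lemma10 : ∀ {c ℓ} (R : CommutativeRing c ℓ) (n : ℕ) → 2 ≤ n →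
    let open CommutativeRing R using (_≈_) in
    let open Linear R in
    (o : VecΥ n) → IsSE o →
    Σ (VecΥc n) λ τ →
      ((η : VecΥ n) → ⟨ o , η ⟩Υ ≈ ⟨ τ , cvec η ⟩Υc)
      × ((τ′ : VecΥc n) → ((η : VecΥ n) → ⟨ o , η ⟩Υ ≈ ⟨ τ′ , cvec η ⟩Υc) →
           (T : Subset n) → 2 ≤ ∣ T ∣ → τ′ T ≈ τ T)
      × ((T : Subset n) (b : Fin n) → 2 ≤ ∣ T ∣ → b ∈ T → τ T ≈ formula o T b)
lemma10 R n _ o se = τ R o , represents , unique , λ T b _ b∈T → τ-formula R se b∈T
  where
  open CommutativeRing R using (_≈_; trans; sym)
  open Linear R

  represents : (η : VecΥ n) → ⟨ o , η ⟩Υ ≈ ⟨ τ R o , cvec η ⟩Υc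
  represents = pairing-from-weight R (weight-τ≈o R se)

  unique : (τ′ : VecΥc n) → ((η : VecΥ n) → ⟨ o , η ⟩Υ ≈ ⟨ τ′ , cvec η ⟩Υc) → (T : Subset n) → 2 ≤ ∣ T ∣ → τ′ T ≈ τ R o T
  unique τ′ represents T 2≤∣T∣ with Equivalence.from Nonempty⇔1≤∣p∣ (≤-trans (s≤s z≤n) 2≤∣T∣)
  ... | a , a∈T = trans (weight-determines R (weight-from-pairing R represents) a∈T 2≤∣T∣) (sym (τ≈μ R se a∈T))
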